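{- Let $\mathcal D$ be an $s$-bounded abstract system of proof notations and $d\in\mathrm{Ecl}(\mathcal D)$. Then $\mathrm{Ecl}(\mathcal D)\restriction d=\{d'\in\mathrm{Ecl}(\mathcal D)\mid d\to^\ast d'\}$ is $\vartheta_d(s)$-bounded, i.e. $|d'|\le\vartheta_d(s)$ for every $d'\in\mathrm{Ecl}(\mathcal D)$ with $d\to^\ast d'$.
   Context: An abstract system of proof notations is a set $\mathcal D$ together with two functions $|\cdot|,\|\cdot\|\colon\mathcal D\to\mathbb N\setminus\{0\}$ ("size" and "height") and a relation $\to\,\subseteq\mathcal D\times\mathcal D$ such that $d\to d'$ implies $\|d'\|<\|d\|$; $\to^\ast$ is its reflexive transitive closure. $\mathcal D$ is $s$-bounded if $|d|\le s$ for all $d\in\mathcal D$. The cut elimination closure $\mathrm{Ecl}(\mathcal D)$ is defined inductively, with new symbols $\mathsf I,\mathsf R,\mathsf E$: every $d\in\mathcal D$ is in $\mathrm{Ecl}(\mathcal D)$ (with its size and height); if $d,e\in\mathrm{Ecl}(\mathcal D)$ then $\mathsf I d,\ \mathsf R de,\ \mathsf E d\in\mathrm{Ecl}(\mathcal D)$, with $|\mathsf I d|=|d|+1$, $|\mathsf R de|=|d|+|e|+1$, $|\mathsf E d|=|d|+1$, and $\|\mathsf I d\|=\|d\|$, $\|\mathsf R de\|=\|d\|+\|e\|$, $\|\mathsf E d\|=2^{\|d\|}-1$. The relation $\to$ on $\mathrm{Ecl}(\mathcal D)$ is inductively generated by: $d\to d'$ whenever this holds in $\mathcal D$; if $d\to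 d'$ then $\mathsf I d\to\mathsf I d'$ and $\mathsf E d\to\mathsf E d'$; if $e\to e'$ then $\mathsf R de\to\mathsf R de'$; $\mathsf R de\to\mathsf I d$ always; if $d\to d'$ and $d\to d''$ then $\mathsf E d\to\mathsf R(\mathsf E d')(\mathsf E d'')$. Size functions: to each $d\in\mathrm{Ecl}(\mathcal D)$ a monotone function $\vartheta_d\colon\mathbb N\to\mathbb N$ is assigned by recursion: $\vartheta_d(s)=s$ for $d\in\mathcal D$; $\vartheta_{\mathsf I d}(s)=\vartheta_d(s)+1$; $\vartheta_{\mathsf R de}(s)=\max\{|d|+1+\vartheta_e(s),\ \vartheta_d(s)+1\}$; $\vartheta_{\mathsf E d}(s)=\|d\|\cdot(\vartheta_d(s)+2)$. -}

module Defs where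

open import Level using (Level) renaming (_⊔_ to _⊔ℓ_)
open import Data.Nat using (ℕ; _+_; _*_; _∸_; _^_; _≤_; _<_; _⊔_)
  renaming (suc to sucℕ)
open import Relation.Binary.Construct.Closure.ReflexiveTransitive using (Star)

record ASPN (a r : Level) : Set (Level.suc (a ⊔ℓ r)) where
  field
    Carrier   : Set a
    size      : Carrier → ℕ
    height    : Carrier → ℕ
    size-pos   : ∀ d → 0 < size d
    height-pos : ∀ d → 0 < height d
    _⟶_       : Carrier → Carrier → Set r
    height-dec : ∀ {d d'} → d ⟶ d' → height d' < height d

SBounded : ∀ {a r} → ASPN a r → ℕ → Set a
SBounded 𝒟 s = ∀ d → ASPN.size 𝒟 d ≤ s

module _ {a r} (𝒟 : ASPN a r) where
  open ASPN 𝒟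

  data Ecl : Set a where
    base : Carrier → Ecl
    I    : Ecl → Ecl
    R    : Ecl → Ecl → Ecl
    E    : Ecl → Ecl

  esize : Ecl → ℕ
  esize (base d) = size d
  esize (I d)    = sucℕ (esize d)
  esize (R d e)  = esize d + esize e + 1
  esize (E d)    = sucℕ (esize d)

  eheight : Ecl → ℕ
  eheight (base d) = height d
  eheight (I d)    = eheight d
  eheight (R d e)  = eheight d + eheight e
  eheight (E d)    = 2 ^ eheight d ∸ 1

  data _⇒_ : Ecl → Ecl → Set (a ⊔ℓ r) where
    base-step : ∀ {d d'} → d ⟶ d' → base d ⇒ base d'
    I-step    : ∀ {d d'} → d ⇒ d' → I d ⇒ I d'
    E-step    : ∀ {d d'} → d ⇒ d' → E d ⇒ E d'
    R-step    : ∀ {d e e'} → e ⇒ e' → R d e ⇒ R d e'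
    R-I       : ∀ {d e} → R d e ⇒ I d
    E-R       : ∀ {d d' d''} → d ⇒ d' → d ⇒ d'' → E d ⇒ R (E d') (E d'')

  _⇒*_ : Ecl → Ecl → Set (a ⊔ℓ r)
  _⇒*_ = Star _⇒_

  ϑ : Ecl → ℕ → ℕ
  ϑ (base d) s = s
  ϑ (I d)    s = sucℕ (ϑ d s)
  ϑ (R d e)  s = (esize d + 1 + ϑ e s) ⊔ (ϑ d s + 1)
  ϑ (E d)    s = eheight d * (ϑ d s + 2)

-- The argument has two halves:
--   (1) |d| ≤ ϑ_d(s) for every d (the size function bounds the size itself);
--   (2) ϑ does not increase along a single reduction step, hence (by a generic
--       fact about reflexive–transitive closures) along any reduction sequence.
-- Then |d'| ≤ ϑ_{d'}(s) ≤ ϑ_d(s).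
-- Both halves need the height to be positive and strictly decreasing along ⇒
-- on all of Ecl(𝒟) (so that Ecl(𝒟) is again a system of proof notations); for
-- the steps through E this rests on two facts about h ↦ 2^h ∸ 1, proved first
-- together with the arithmetic estimate used for the critical step E-R.

module Submission where

open import Defs
open import Level using (Level)
open import Data.Nat using (ℕ; _≤_; suc; _+_; _*_; _∸_; _^_; _<_; z≤n; s≤s; >-nonZero)
open import Data.Nat.Properties
open import Relation.Binary.Core using (Rel)
open import Relation.Binary.Construct.Closure.ReflexiveTransitive using (Star; ε; _◅_)
open import Relation.Binary.PropositionalEquality using (sym; cong)

2^-∸1-mono-< : ∀ {a b} → a < b → 2 ^ a ∸ 1 < 2 ^ b ∸ 1
2^-∸1-mono-< {a} a<b = ∸-monoˡ-< (^-monoʳ-< 2 (s≤s (s≤s z≤n)) a<b) (m^n>0 2 a)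

pred-sum-< : ∀ {x y m} → 0 < x → 0 < y → x ≤ m → y ≤ m → (x ∸ 1) + (y ∸ 1) < 2 * m ∸ 1
pred-sum-< {suc x} {suc y} {suc m} _ _ (s≤s x≤m) (s≤s y≤m) = begin-strict
  x + y              ≤⟨ +-mono-≤ x≤m y≤m ⟩
  m + m              <⟨ +-monoʳ-< m (n<1+n m) ⟩
  m + suc m          ≡⟨ cong (λ n → m + suc n) (sym (+-identityʳ m)) ⟩
  m + suc (m + 0)    ∎
  where open ≤-Reasoning

-- The heights of E d' and E d'' together stay below that of E d when d' and
-- d'' are lower than d: this is what makes the step E d ⇒ R (E d') (E d'')
-- decreasing.
2^-∸1-sum-< : ∀ {a b h} → a < h → b < h → (2 ^ a ∸ 1) + (2 ^ b ∸ 1) < 2 ^ h ∸ 1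
2^-∸1-sum-< {a} {b} (s≤s a≤k) (s≤s b≤k) =
  pred-sum-< (m^n>0 2 a) (m^n>0 2 b) (^-monoʳ-≤ 2 a≤k) (^-monoʳ-≤ 2 b≤k)

-- The estimate behind ϑ_{E d} = ‖d‖·(ϑ_d(s)+2): one extra summand c ≤ t + 2
-- is absorbed when a lower height a < h multiplies a smaller value x ≤ t.
absorb-summand : ∀ {c a h x t} → c ≤ t + 2 → a < h → x ≤ t → c + a * (x + 2) ≤ h * (t + 2)
absorb-summand c≤t+2 (s≤s a≤k) x≤t = +-mono-≤ c≤t+2 (*-mono-≤ a≤k (+-monoˡ-≤ 2 x≤t))

star-antitone : ∀ {a ℓ} {A : Set a} {T : Rel A ℓ} (f : A → ℕ) →
                (∀ {x y} → T x y → f y ≤ f x) → ∀ {x y} → Star T x y → f y ≤ f x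
star-antitone f step ε          = ≤-refl
star-antitone f step (t ◅ rest) = ≤-trans (star-antitone f step rest) (step t)

module _ {a r : Level} (𝒟 : ASPN a r) where
  open ASPN 𝒟 using (height-pos; height-dec)

  eheight-pos : ∀ d → 0 < eheight 𝒟 d
  eheight-pos (base x) = height-pos x
  eheight-pos (I d)    = eheight-pos d
  eheight-pos (R d e)  = ≤-trans (eheight-pos d) (m≤m+n _ _)
  eheight-pos (E d)    = 2^-∸1-mono-< (eheight-pos d)

  eheight-dec : ∀ {d d'} → _⇒_ 𝒟 d d' → eheight 𝒟 d' < eheight 𝒟 d
  eheight-dec (base-step st)   = height-dec st
  eheight-dec (I-step st)      = eheight-dec st
  eheight-dec (E-step st)      = 2^-∸1-mono-< (eheight-dec st)
  eheight-dec (R-step {d} st)  = +-monoʳ-< (eheight 𝒟 d) (eheight-dec st)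
  eheight-dec (R-I {d} {e})    = m<m+n (eheight 𝒟 d) (eheight-pos e)
  eheight-dec (E-R st₁ st₂)    = 2^-∸1-sum-< (eheight-dec st₁) (eheight-dec st₂)

  module _ (s : ℕ) (bounded : SBounded 𝒟 s) where

    esize≤ϑ : ∀ d → esize 𝒟 d ≤ ϑ 𝒟 d s
    esize≤ϑ (base x) = bounded x
    esize≤ϑ (I d)    = s≤s (esize≤ϑ d)
    esize≤ϑ (R d e)  = m≤n⇒m≤n⊔o _ (begin
      esize 𝒟 d + esize 𝒟 e + 1    ≡⟨ +-assoc (esize 𝒟 d) (esize 𝒟 e) 1 ⟩
      esize 𝒟 d + (esize 𝒟 e + 1)  ≡⟨ cong (esize 𝒟 d +_) (+-comm (esize 𝒟 e) 1) ⟩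
      esize 𝒟 d + (1 + esize 𝒟 e)  ≡⟨ sym (+-assoc (esize 𝒟 d) 1 (esize 𝒟 e)) ⟩
      esize 𝒟 d + 1 + esize 𝒟 e    ≤⟨ +-monoʳ-≤ (esize 𝒟 d + 1) (esize≤ϑ e) ⟩
      esize 𝒟 d + 1 + ϑ 𝒟 e s      ∎)
      where open ≤-Reasoning
    esize≤ϑ (E d)    = begin
      suc (esize 𝒟 d)              ≤⟨ n≤1+n _ ⟩
      2 + esize 𝒟 d                ≡⟨ +-comm 2 (esize 𝒟 d) ⟩
      esize 𝒟 d + 2                ≤⟨ +-monoˡ-≤ 2 (esize≤ϑ d) ⟩
      ϑ 𝒟 d s + 2                  ≤⟨ m≤n*m (ϑ 𝒟 d s + 2) (eheight 𝒟 d) {{>-nonZero (eheight-pos d)}} ⟩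
      eheight 𝒟 d * (ϑ 𝒟 d s + 2)  ∎
      where open ≤-Reasoning

    ϑ-step : ∀ {d d'} → _⇒_ 𝒟 d d' → ϑ 𝒟 d' s ≤ ϑ 𝒟 d s
    ϑ-step (base-step _)    = ≤-refl
    ϑ-step (I-step st)      = s≤s (ϑ-step st)
    ϑ-step (E-step st)      = *-mono-≤ (<⇒≤ (eheight-dec st)) (+-monoˡ-≤ 2 (ϑ-step st))
    ϑ-step (R-step {d} st)  = ⊔-monoˡ-≤ _ (+-monoʳ-≤ (esize 𝒟 d + 1) (ϑ-step st))
    ϑ-step (R-I {d})        = m≤n⇒m≤o⊔n _ (≤-reflexive (+-comm 1 (ϑ 𝒟 d s)))
    ϑ-step (E-R {d} {d'} {d''} st₁ st₂) = ⊔-lub left right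
      where
      -- ϑ_{R (E d') (E d'')}(s) is the maximum of these two terms; both are
      -- absorbed into ‖d‖·(ϑ_d(s)+2) because d', d'' are lower than d.
      t = ϑ 𝒟 d s
      |d'|+2≤t+2 : suc (esize 𝒟 d') + 1 ≤ t + 2
      |d'|+2≤t+2 = ≤-trans (≤-reflexive (sym (+-suc (esize 𝒟 d') 1)))
                           (+-monoˡ-≤ 2 (≤-trans (esize≤ϑ d') (ϑ-step st₁)))
      left  : esize 𝒟 (E d') + 1 + ϑ 𝒟 (E d'') s ≤ ϑ 𝒟 (E d) s
      left  = absorb-summand |d'|+2≤t+2 (eheight-dec st₂) (ϑ-step st₂)
      right : ϑ 𝒟 (E d') s + 1 ≤ ϑ 𝒟 (E d) s
      right = ≤-trans (≤-reflexive (+-comm (ϑ 𝒟 (E d') s) 1))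
                      (absorb-summand (≤-trans (s≤s z≤n) (m≤n+m 2 t)) (eheight-dec st₁) (ϑ-step st₁))

mainTheorem5 : ∀ {a r : Level} (𝒟 : ASPN a r) (s : ℕ) → SBounded 𝒟 s →
    ∀ (d d' : Ecl 𝒟) → _⇒*_ 𝒟 d d' → esize 𝒟 d' ≤ ϑ 𝒟 d s
mainTheorem5 𝒟 s bounded d d' d⇒*d' = begin
  esize 𝒟 d'   ≤⟨ esize≤ϑ 𝒟 s bounded d' ⟩
  ϑ 𝒟 d' s     ≤⟨ star-antitone (λ e → ϑ 𝒟 e s) (ϑ-step 𝒟 s bounded) d⇒*d' ⟩
  ϑ 𝒟 d s      ∎
  where open ≤-Reasoning
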